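{- Let $G$ be a finite simple graph that is $\{P_4+K_1, K_{1,3}\}$-free. Then $\chi(G)\le 2\omega(G)-1$.
   Context: $\chi(G)$ is the chromatic number and $\omega(G)$ the clique number. $P_4+K_1$ denotes the join of the path $P_4$ with a single vertex (the gem): a path $p_1p_2p_3p_4$ plus a vertex adjacent to all of $p_1,\dots,p_4$. $K_{1,3}$ is the claw. A graph is $\{H_1,\dots,H_k\}$-free if it has no induced subgraph isomorphic to any $H_i$. -}

module Defs where

open import Data.Nat using (ℕ; suc; _*_; _∸_)
open import Data.Fin using (Fin; zero; suc)
open import Data.Bool using (Bool; true; false)
open import Data.Product using (Σ; _×_)
open import Relation.Binary.PropositionalEquality using (_≡_; _≢_)
open import Function.Definitions using (Injective)
open import Relation.Nullary using (¬_)

record Graph : Set where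
  field
    n     : ℕ
    adj   : Fin n → Fin n → Bool
    irrefl : ∀ v → adj v v ≡ false
    sym    : ∀ u v → adj u v ≡ adj v u
open Graph public

record InducedEmbedding (H G : Graph) : Set where
  field
    f      : Fin (n H) → Fin (n G)
    inj    : Injective _≡_ _≡_ f
    preserve : ∀ u v → adj G (f u) (f v) ≡ adj H u v

_≼ᵢ_ : Graph → Graph → Set
H ≼ᵢ G = InducedEmbedding H G

_Free : Graph → Graph → Set
(H Free) G = ¬ (H ≼ᵢ G)

clawAdj : Fin 4 → Fin 4 → Bool
clawAdj zero (suc _) = true
clawAdj (suc _) zero = true
clawAdj _ _ = false

claw : Graph
claw = record { n = 4 ; adj = clawAdj ; irrefl = ir ; sym = sy }
  where
  ir : ∀ v → clawAdj v v ≡ false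
  ir zero = _≡_.refl
  ir (suc v) = _≡_.refl
  sy : ∀ u v → clawAdj u v ≡ clawAdj v u
  sy zero zero = _≡_.refl
  sy zero (suc v) = _≡_.refl
  sy (suc u) zero = _≡_.refl
  sy (suc u) (suc v) = _≡_.refl

-- The gem P_4 + K_1: path p1 p2 p3 p4 = vertices 0-1-2-3, plus vertex 4
-- adjacent to all of 0..3.
gemAdj : Fin 5 → Fin 5 → Bool
gemAdj zero (suc zero) = true
gemAdj (suc zero) zero = true
gemAdj (suc zero) (suc (suc zero)) = true
gemAdj (suc (suc zero)) (suc zero) = true
gemAdj (suc (suc zero)) (suc (suc (suc zero))) = true
gemAdj (suc (suc (suc zero))) (suc (suc zero)) = true
gemAdj (suc (suc (suc (suc zero)))) (suc (suc (suc (suc zero)))) = false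
gemAdj (suc (suc (suc (suc zero)))) _ = true
gemAdj _ (suc (suc (suc (suc zero)))) = true
gemAdj _ _ = false

gem : Graph
gem = record { n = 5 ; adj = gemAdj ; irrefl = ir ; sym = sy }
  where
  ir : ∀ v → gemAdj v v ≡ false
  ir zero = _≡_.refl
  ir (suc zero) = _≡_.refl
  ir (suc (suc zero)) = _≡_.refl
  ir (suc (suc (suc zero))) = _≡_.refl
  ir (suc (suc (suc (suc zero)))) = _≡_.refl
  sy : ∀ u v → gemAdj u v ≡ gemAdj v u
  sy zero zero = _≡_.refl
  sy zero (suc zero) = _≡_.refl
  sy zero (suc (suc zero)) = _≡_.refl
  sy zero (suc (suc (suc zero))) = _≡_.refl
  sy zero (suc (suc (suc (suc zero)))) = _≡_.refl
  sy (suc zero) zero = _≡_.refl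
  sy (suc zero) (suc zero) = _≡_.refl
  sy (suc zero) (suc (suc zero)) = _≡_.refl
  sy (suc zero) (suc (suc (suc zero))) = _≡_.refl
  sy (suc zero) (suc (suc (suc (suc zero)))) = _≡_.refl
  sy (suc (suc zero)) zero = _≡_.refl
  sy (suc (suc zero)) (suc zero) = _≡_.refl
  sy (suc (suc zero)) (suc (suc zero)) = _≡_.refl
  sy (suc (suc zero)) (suc (suc (suc zero))) = _≡_.refl
  sy (suc (suc zero)) (suc (suc (suc (suc zero)))) = _≡_.refl
  sy (suc (suc (suc zero))) zero = _≡_.refl
  sy (suc (suc (suc zero))) (suc zero) = _≡_.refl
  sy (suc (suc (suc zero))) (suc (suc zero)) = _≡_.refl
  sy (suc (suc (suc zero))) (suc (suc (suc zero))) = _≡_.refl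
  sy (suc (suc (suc zero))) (suc (suc (suc (suc zero)))) = _≡_.refl
  sy (suc (suc (suc (suc zero)))) zero = _≡_.refl
  sy (suc (suc (suc (suc zero)))) (suc zero) = _≡_.refl
  sy (suc (suc (suc (suc zero)))) (suc (suc zero)) = _≡_.refl
  sy (suc (suc (suc (suc zero)))) (suc (suc (suc zero))) = _≡_.refl
  sy (suc (suc (suc (suc zero)))) (suc (suc (suc (suc zero)))) = _≡_.refl

HasClique : Graph → ℕ → Set
HasClique G k = Σ (Fin k → Fin (n G)) λ c →
  Injective _≡_ _≡_ c × (∀ i j → i ≢ j → adj G (c i) (c j) ≡ true)

IsCliqueNumber : Graph → ℕ → Set
IsCliqueNumber G w = HasClique G w × ¬ HasClique G (suc w)

Colorable : Graph → ℕ → Set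
Colorable G k = Σ (Fin (n G) → Fin k) λ col →
  ∀ u v → adj G u v ≡ true → col u ≢ col v

-- χ(G) ≤ k  iff  G has a proper k-colouring (χ is the least such k).

{-# OPTIONS --safe #-}

-- In a {gem, claw}-free graph the neighbourhood of every vertex induces a {P₄, 3K₁}-free
-- graph, and such a graph S has a clique of size at least |S|/2.  For x ∈ S, the vertices
-- of S other than x not adjacent to x form a clique `far` (no 3K₁); x together with its
-- neighbours having a non-neighbour in `far` form a clique `near` (no 3K₁, no P₄); the other
-- neighbours of x, `joined`, are complete to both (no P₄).  A clique of `joined`, found by
-- induction, plus the larger of `far` and `near` is the required clique.  So every degree is
-- at most 2(ω − 1), and greedy colouring uses at most 2ω − 1 colours.
module Submission where

open import Defs
open import Data.Bool using (Bool; true; false; not; _∧_; _∨_; if_then_else_)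
open import Data.Bool.Properties using (¬-not) renaming (_≟_ to _≟ᵇ_)
open import Data.Empty using (⊥; ⊥-elim)
open import Data.Fin using (Fin; zero; suc; toℕ; fromℕ<; inject≤; _≟_)
open import Data.Fin.Properties
  using (any?; all?; ¬∀⟶∃¬; injective⇒≤; suc-injective; inject≤-injective; toℕ-fromℕ<; toℕ-injective
        ; toℕ<n)
open import Data.Nat using (ℕ; zero; suc; _+_; _*_; _∸_; _≤_; _<_; _≤?_; z≤n; s≤s; s≤s⁻¹)
open import Data.Nat.Induction using (<-wellFounded)
open import Data.Nat.Properties
  using (≤-refl; ≤-trans; <-≤-trans; ≤∧≢⇒<; ≮⇒≥; ≰⇒≥; <⇒≱; m≤m+n; m<m+n; n≤1+n; +-mono-≤
        ; +-identityʳ; +-assoc; +-suc; *-suc; *-monoʳ-≤; *-distribˡ-+; module ≤-Reasoning)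
open import Data.Product using (Σ; ∃; _×_; _,_; proj₁; proj₂)
open import Data.Sum using (_⊎_; inj₁; inj₂; [_,_])
open import Function using (_∘_; id)
open import Function.Definitions using (Injective)
open import Induction.WellFounded as WF using ()
open import Level using (0ℓ)
open import Relation.Binary.Construct.On as On using ()
open import Relation.Binary.PropositionalEquality as ≡ using (_≡_; _≢_; refl; cong; ≢-sym)
open import Relation.Nullary using (¬_; Dec; yes; no; does)
open import Relation.Nullary.Decidable using (_×-dec_; _→-dec_; from-yes)
open import Relation.Unary using (Pred; Decidable)

-- Subsets as Boolean predicates rather than Data.Fin.Subset's vectors, so that a set given
-- by a decidable condition needs no tabulation.
Subset : ℕ → Set
Subset m = Fin m → Bool

module _ {m : ℕ} where

  infix  4 _∈_ _∉_ _⊆_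
  infixl 7 _∩_ _─_
  infixl 6 _∪_

  _∈_ _∉_ : Fin m → Subset m → Set
  y ∈ p = p y ≡ true
  y ∉ p = p y ≡ false

  _⊆_ : Subset m → Subset m → Set
  p ⊆ q = ∀ {y} → y ∈ p → y ∈ q

  _∩_ _∪_ _─_ : Subset m → Subset m → Subset m
  (p ∩ q) y = p y ∧ q y
  (p ∪ q) y = p y ∨ q y
  (p ─ q) y = p y ∧ not (q y)

  ∈∩⁻ : ∀ p q {y} → y ∈ p ∩ q → y ∈ p × y ∈ q
  ∈∩⁻ p q {y} with p y | q y
  ... | true | true = λ _ → refl , refl

  ∈∩⁺ : ∀ p q {y} → y ∈ p → y ∈ q → y ∈ p ∩ q
  ∈∩⁺ p q y∈p y∈q = ≡.cong₂ _∧_ y∈p y∈q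

  ∈─⁻ : ∀ p q {y} → y ∈ p ─ q → y ∈ p × y ∉ q
  ∈─⁻ p q {y} with p y | q y
  ... | true | false = λ _ → refl , refl

  ∈─⁺ : ∀ p q {y} → y ∈ p → y ∉ q → y ∈ p ─ q
  ∈─⁺ p q y∈p y∉q = ≡.cong₂ _∧_ y∈p (cong not y∉q)

  ∈∪⁻ : ∀ p q {y} → y ∈ p ∪ q → y ∈ p ⊎ y ∈ q
  ∈∪⁻ p q {y} with p y
  ... | true  = λ _ → inj₁ refl
  ... | false = inj₂

  ∈∪⁺ʳ : ∀ p q {y} → y ∈ q → y ∈ p ∪ q
  ∈∪⁺ʳ p q {y} y∈q with p y
  ... | true  = refl
  ... | false = y∈q

  ∉∪⁻ : ∀ p q {y} → y ∉ p ∪ q → y ∉ p × y ∉ q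
  ∉∪⁻ p q {y} with p y | q y
  ... | false | false = λ _ → refl , refl

  ∉─⁺ : ∀ p q {y} → y ∉ p → y ∉ p ─ q
  ∉─⁺ p q y∉p = cong (_∧ _) y∉p

  ∉─⁻ : ∀ p q {y} → y ∉ p ─ q → y ∉ p ⊎ y ∈ q
  ∉─⁻ p q {y} with p y | q y
  ... | false | _    = λ _ → inj₁ refl
  ... | true  | true = λ _ → inj₂ refl

  ⟦_⟧ : {P : Pred (Fin m) 0ℓ} → Decidable P → Subset m
  ⟦ P? ⟧ y = does (P? y)

  ∈⟦⟧⁺ : ∀ {P : Pred (Fin m) 0ℓ} (P? : Decidable P) {y} → P y → y ∈ ⟦ P? ⟧
  ∈⟦⟧⁺ P? {y} Py with P? y
  ... | yes _  = refl
  ... | no ¬Py = ⊥-elim (¬Py Py)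

  ∈⟦⟧⁻ : ∀ {P : Pred (Fin m) 0ℓ} (P? : Decidable P) {y} → y ∈ ⟦ P? ⟧ → P y
  ∈⟦⟧⁻ P? {y} with P? y
  ... | yes Py = λ _ → Py

  ∉⟦⟧⁻ : ∀ {P : Pred (Fin m) 0ℓ} (P? : Decidable P) {y} → y ∉ ⟦ P? ⟧ → ¬ P y
  ∉⟦⟧⁻ P? {y} with P? y
  ... | no ¬Py = λ _ → ¬Py

  ⁅_⁆ : Fin m → Subset m
  ⁅ x ⁆ = ⟦ _≟ x ⟧

∣_∣ : ∀ {m} → Subset m → ℕ
∣_∣ {zero}  p = 0
∣_∣ {suc m} p = if p zero then suc ∣ p ∘ suc ∣ else ∣ p ∘ suc ∣

∣p∩q∣+∣p─q∣≡∣p∣ : ∀ {m} (p q : Subset m) → ∣ p ∩ q ∣ + ∣ p ─ q ∣ ≡ ∣ p ∣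
∣p∩q∣+∣p─q∣≡∣p∣ {zero}  p q = refl
∣p∩q∣+∣p─q∣≡∣p∣ {suc m} p q with p zero | q zero | ∣p∩q∣+∣p─q∣≡∣p∣ (p ∘ suc) (q ∘ suc)
... | true  | true  | ih = cong suc ih
... | true  | false | ih = ≡.trans (+-suc _ _) (cong suc ih)
... | false | _     | ih = ih

∣p∪q∣≡∣p∣+∣q∣ : ∀ {m} (p q : Subset m) → (∀ {y} → y ∈ p → y ∉ q) →
                ∣ p ∪ q ∣ ≡ ∣ p ∣ + ∣ q ∣
∣p∪q∣≡∣p∣+∣q∣ {zero}  p q disj = refl
∣p∪q∣≡∣p∣+∣q∣ {suc m} p q disj with p zero | q zero | disj {zero}
  | ∣p∪q∣≡∣p∣+∣q∣ (p ∘ suc) (q ∘ suc) disj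
... | true  | true  | d | _  with () ← d refl
... | true  | false | _ | ih = cong suc ih
... | false | true  | _ | ih = ≡.trans (cong suc ih) (≡.sym (+-suc _ _))
... | false | false | _ | ih = ih

x∈p⇒0<∣p∣ : ∀ {m} (p : Subset m) {x} → x ∈ p → 0 < ∣ p ∣
x∈p⇒0<∣p∣ {suc m} p {zero} x∈p with p zero
x∈p⇒0<∣p∣ {suc m} p {zero} x∈p | true  = s≤s z≤n
x∈p⇒0<∣p∣ {suc m} p {zero} ()  | false
x∈p⇒0<∣p∣ {suc m} p {suc x} x∈p with p zero
... | true  = s≤s z≤n
... | false = x∈p⇒0<∣p∣ (p ∘ suc) x∈p

rank : ∀ {m} (p : Subset m) {y} → y ∈ p → Fin ∣ p ∣
rank {suc m} p {zero} y∈p with p zero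
rank {suc m} p {zero} y∈p | true  = zero
rank {suc m} p {zero} ()  | false
rank {suc m} p {suc y} y∈p with p zero
... | true  = suc (rank (p ∘ suc) y∈p)
... | false = rank (p ∘ suc) y∈p

rank-injective : ∀ {m} (p : Subset m) {y z} (y∈p : y ∈ p) (z∈p : z ∈ p) →
                 rank p y∈p ≡ rank p z∈p → y ≡ z
rank-injective {suc m} p {zero}  {zero}  _   _   _ = refl
rank-injective {suc m} p {suc y} {suc z} y∈p z∈p eq with p zero
... | true  = cong suc (rank-injective (p ∘ suc) y∈p z∈p (suc-injective eq))
... | false = cong suc (rank-injective (p ∘ suc) y∈p z∈p eq)
rank-injective {suc m} p {zero}  {suc z} y∈p z∈p eq with p zero
rank-injective {suc m} p {zero}  {suc z} y∈p z∈p () | true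
rank-injective {suc m} p {zero}  {suc z} ()  z∈p eq | false
rank-injective {suc m} p {suc y} {zero}  y∈p z∈p eq with p zero
rank-injective {suc m} p {suc y} {zero}  y∈p z∈p () | true
rank-injective {suc m} p {suc y} {zero}  y∈p ()  eq | false

enumerate : ∀ {m} (p : Subset m) → Fin ∣ p ∣ → Fin m
enumerate {suc m} p i with p zero
enumerate {suc m} p zero    | true  = zero
enumerate {suc m} p (suc i) | true  = suc (enumerate (p ∘ suc) i)
enumerate {suc m} p i       | false = suc (enumerate (p ∘ suc) i)

enumerate-∈ : ∀ {m} (p : Subset m) i → enumerate p i ∈ p
enumerate-∈ {suc m} p i with p zero in p₀
enumerate-∈ {suc m} p zero    | true  = p₀
enumerate-∈ {suc m} p (suc i) | true  = enumerate-∈ (p ∘ suc) i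
enumerate-∈ {suc m} p i       | false = enumerate-∈ (p ∘ suc) i

enumerate-injective : ∀ {m} (p : Subset m) → Injective _≡_ _≡_ (enumerate p)
enumerate-injective {suc m} p {i} {j} with p zero
enumerate-injective {suc m} p {zero}  {zero}  | true = λ _ → refl
enumerate-injective {suc m} p {suc i} {suc j} | true =
  cong suc ∘ enumerate-injective (p ∘ suc) ∘ suc-injective
enumerate-injective {suc m} p {i} {j} | false = enumerate-injective (p ∘ suc) ∘ suc-injective
enumerate-injective {suc m} p {zero}  {suc j} | true = λ ()
enumerate-injective {suc m} p {suc i} {zero}  | true = λ ()

injection⇒≤∣p∣ : ∀ {m k} (p : Subset m) (f : Fin k → Fin m) →
                 Injective _≡_ _≡_ f → (∀ i → f i ∈ p) → k ≤ ∣ p ∣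
injection⇒≤∣p∣ p f f-inj f∈p =
  injective⇒≤ {f = λ i → rank p (f∈p i)} (f-inj ∘ rank-injective p (f∈p _) (f∈p _))

+-≤-double : ∀ {i j k} → i ≤ k → j ≤ k → i + j ≤ 2 * k
+-≤-double {i} {j} {k} i≤k j≤k =
  ≡.subst (i + j ≤_) (cong (k +_) (≡.sym (+-identityʳ k))) (+-mono-≤ i≤k j≤k)

free-colour : ∀ {m k} (col : Fin m → Fin k) (p : Subset m) → ∣ p ∣ < k →
              ∃ λ c → ∀ {y} → y ∈ p → col y ≢ c
free-colour {m} {k} col p ∣p∣<k = decide (all? used?)
  where
  Used : Fin k → Set
  Used c = ∃ λ y → y ∈ p × col y ≡ c

  used? : ∀ c → Dec (Used c)
  used? c = any? λ y → (p y ≟ᵇ true) ×-dec (col y ≟ c)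

  decide : Dec (∀ c → Used c) → ∃ λ c → ∀ {y} → y ∈ p → col y ≢ c
  decide (no some-unused) with c , unused ← ¬∀⟶∃¬ k Used used? some-unused =
    c , λ y∈p col-y≡c → unused (_ , y∈p , col-y≡c)
  decide (yes used) = ⊥-elim (<⇒≱ ∣p∣<k (injection⇒≤∣p∣ p witness witness-injective witness-∈))
    where
    witness : Fin k → Fin m
    witness = proj₁ ∘ used
    witness-∈ : ∀ c → witness c ∈ p
    witness-∈ = proj₁ ∘ proj₂ ∘ used
    witness-injective : Injective _≡_ _≡_ witness
    witness-injective {c} {c′} eq =
      ≡.trans (≡.sym (proj₂ (proj₂ (used c)))) (≡.trans (cong col eq) (proj₂ (proj₂ (used c′))))

Twins : (H : Graph) → Fin (n H) → Fin (n H) → Set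
Twins H u v = ∀ w → adj H u w ≡ adj H v w

embedding : ∀ {H G} (f : Fin (n H) → Fin (n G)) → (∀ u v → adj G (f u) (f v) ≡ adj H u v) →
            (∀ {u v} → Twins H u v → f u ≡ f v → u ≡ v) → H ≼ᵢ G
embedding {H} {G} f preserve twins-separated =
  record { f = f ; inj = λ fu≡fv → twins-separated (twins fu≡fv) fu≡fv ; preserve = preserve }
  where
  twins : ∀ {u v} → f u ≡ f v → Twins H u v
  twins {u} {v} fu≡fv w =
    ≡.trans (≡.sym (preserve u w)) (≡.trans (cong (λ z → adj G z (f w)) fu≡fv) (preserve v w))

gem-twinFree : ∀ {u v} → Twins gem u v → u ≡ v
gem-twinFree {u} {v} = from-yes twinFree? u v
  where
  twinFree? : Dec (∀ u v → Twins gem u v → u ≡ v)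
  twinFree? = all? λ u → all? λ v → all? (λ w → adj gem u w ≟ᵇ adj gem v w) →-dec u ≟ v

module _ (G : Graph) where

  private
    V : Set
    V = Fin (n G)

  infix 4 _~_ _≁_
  _~_ _≁_ : V → V → Set
  u ~ v = adj G u v ≡ true
  u ≁ v = adj G u v ≡ false

  ~-sym : ∀ {u v} → u ~ v → v ~ u
  ~-sym {u} {v} = ≡.trans (Graph.sym G v u)

  ≁-sym : ∀ {u v} → u ≁ v → v ≁ u
  ≁-sym {u} {v} = ≡.trans (Graph.sym G v u)

  ¬≁⇒~ : ∀ {u v} → ¬ u ≁ v → u ~ v
  ¬≁⇒~ = ¬-not

  ¬~⇒≁ : ∀ {u v} → ¬ u ~ v → u ≁ v
  ¬~⇒≁ = ¬-not

  ~⇒≢ : ∀ {u v} → u ~ v → u ≢ v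
  ~⇒≢ {u} u~u refl with () ← ≡.trans (≡.sym u~u) (irrefl G u)

  ~-≁⇒≢ : ∀ {x u v} → x ~ u → x ≁ v → u ≢ v
  ~-≁⇒≢ x~u x≁v refl with () ← ≡.trans (≡.sym x~u) x≁v

  IsClique : Subset (n G) → Set
  IsClique p = ∀ {y z} → y ∈ p → z ∈ p → y ≢ z → y ~ z

  Complete : Subset (n G) → Subset (n G) → Set
  Complete p q = ∀ {y z} → y ∈ p → z ∈ q → y ~ z

  complete⇒disjoint : ∀ {p q} → Complete p q → ∀ {y} → y ∈ p → y ∉ q
  complete⇒disjoint {q = q} p~q {y} y∈p with q y in q-y
  ... | true  = ⊥-elim (~⇒≢ (p~q y∈p q-y) refl)
  ... | false = refl

  clique-∪ : ∀ {p q} → IsClique p → IsClique q → Complete p q → IsClique (p ∪ q)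
  clique-∪ {p} {q} p-clique q-clique p~q y∈p∪q z∈p∪q y≢z
    with ∈∪⁻ p q y∈p∪q | ∈∪⁻ p q z∈p∪q
  ... | inj₁ y∈p | inj₁ z∈p = p-clique y∈p z∈p y≢z
  ... | inj₁ y∈p | inj₂ z∈q = p~q y∈p z∈q
  ... | inj₂ y∈q | inj₁ z∈p = ~-sym (p~q z∈p y∈q)
  ... | inj₂ y∈q | inj₂ z∈q = q-clique y∈q z∈q y≢z

  HasClique-≤ : ∀ {j k} → j ≤ k → HasClique G k → HasClique G j
  HasClique-≤ {j} {k} j≤k (c , c-injective , c-clique) =
    c ∘ restrict , inject≤-injective j≤k j≤k _ _ ∘ c-injective ,
    λ i i′ i≢i′ → c-clique _ _ (i≢i′ ∘ inject≤-injective j≤k j≤k _ _)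
    where
    restrict : Fin j → Fin k
    restrict i = inject≤ i j≤k

  cone-clique : ∀ x p → p ⊆ adj G x → IsClique p → HasClique G (suc ∣ p ∣)
  cone-clique x p p⊆N[x] p-clique = c , c-injective , c-clique
    where
    c : Fin (suc ∣ p ∣) → V
    c zero    = x
    c (suc i) = enumerate p i

    x~c : ∀ i → x ~ c (suc i)
    x~c i = p⊆N[x] (enumerate-∈ p i)

    c-injective : Injective _≡_ _≡_ c
    c-injective {zero}  {zero}  _  = refl
    c-injective {zero}  {suc j} eq = ⊥-elim (~⇒≢ (x~c j) eq)
    c-injective {suc i} {zero}  eq = ⊥-elim (~⇒≢ (x~c i) (≡.sym eq))
    c-injective {suc i} {suc j} eq = cong suc (enumerate-injective p eq)

    c-clique : ∀ i j → i ≢ j → c i ~ c j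
    c-clique zero    zero    0≢0 = ⊥-elim (0≢0 refl)
    c-clique zero    (suc j) _   = x~c j
    c-clique (suc i) zero    _   = ~-sym (x~c i)
    c-clique (suc i) (suc j) i≢j =
      p-clique (enumerate-∈ p i) (enumerate-∈ p j) (i≢j ∘ cong suc ∘ enumerate-injective p)

  vertex-clique : V → HasClique G 1
  vertex-clique x = HasClique-≤ (s≤s z≤n) (cone-clique x (λ _ → false) (λ ()) (λ ()))

  IndependentTripleFree : Subset (n G) → Set
  IndependentTripleFree p = ∀ {a b c} → a ∈ p → b ∈ p → c ∈ p →
    a ≢ b → a ≢ c → b ≢ c → a ≁ b → a ≁ c → b ≁ c → ⊥

  InducedP₄Free : Subset (n G) → Set
  InducedP₄Free p = ∀ {a b c d} → a ∈ p → b ∈ p → c ∈ p → d ∈ p →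
    a ~ b → b ~ c → c ~ d → a ≁ c → b ≁ d → a ≁ d → ⊥

  IndependentTripleFree-⊆ : ∀ {p q} → q ⊆ p → IndependentTripleFree p → IndependentTripleFree q
  IndependentTripleFree-⊆ q⊆p p-free a∈q b∈q c∈q = p-free (q⊆p a∈q) (q⊆p b∈q) (q⊆p c∈q)

  InducedP₄Free-⊆ : ∀ {p q} → q ⊆ p → InducedP₄Free p → InducedP₄Free q
  InducedP₄Free-⊆ q⊆p p-free a∈q b∈q c∈q d∈q = p-free (q⊆p a∈q) (q⊆p b∈q) (q⊆p c∈q) (q⊆p d∈q)

  record HalfClique (p : Subset (n G)) : Set where
    field
      clique    : Subset (n G)
      clique⊆p  : clique ⊆ p
      isClique  : IsClique clique
      half      : ∣ p ∣ ≤ 2 * ∣ clique ∣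

  module Decomposition {S} (S-triple-free : IndependentTripleFree S) (S-P₄-free : InducedP₄Free S)
                       {x} (x∈S : x ∈ S) where

    closedNbhd far : Subset (n G)
    closedNbhd = adj G x ∪ ⁅ x ⁆
    far        = S ─ closedNbhd

    farNonNeighbour? : Decidable λ y → ∃ λ z → z ∈ far × y ≁ z
    farNonNeighbour? y = any? λ z → (far z ≟ᵇ true) ×-dec (adj G y z ≟ᵇ false)

    completeToFar joined near : Subset (n G)
    completeToFar = adj G x ─ ⟦ farNonNeighbour? ⟧
    joined        = S ∩ closedNbhd ∩ completeToFar
    near          = S ∩ closedNbhd ─ completeToFar

    far⁻ : ∀ {y} → y ∈ far → y ∈ S × x ≁ y × y ≢ x
    far⁻ y∈far =
      let y∈S , y∉N[x] = ∈─⁻ S closedNbhd y∈far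
          x≁y , y∉⁅x⁆ = ∉∪⁻ (adj G x) ⁅ x ⁆ y∉N[x]
      in y∈S , x≁y , ∉⟦⟧⁻ (_≟ x) y∉⁅x⁆

    joined⁻ : ∀ {y} → y ∈ joined → y ∈ S × x ~ y × (∀ {z} → z ∈ far → y ~ z)
    joined⁻ y∈joined =
      let y∈S∩N[x] , y∈completeToFar = ∈∩⁻ (S ∩ closedNbhd) completeToFar y∈joined
          x~y , no-farNonNeighbour = ∈─⁻ (adj G x) ⟦ farNonNeighbour? ⟧ y∈completeToFar
      in proj₁ (∈∩⁻ S closedNbhd y∈S∩N[x]) , x~y , λ z∈far →
         ¬≁⇒~ λ y≁z → ∉⟦⟧⁻ farNonNeighbour? no-farNonNeighbour (_ , z∈far , y≁z)

    near⁻ : ∀ {y} → y ∈ near → y ∈ S × (y ≡ x ⊎ x ~ y × ∃ λ z → z ∈ far × y ≁ z)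
    near⁻ y∈near with ∈─⁻ (S ∩ closedNbhd) completeToFar y∈near
    ... | y∈S∩N[x] , y∉completeToFar with ∈∩⁻ S closedNbhd y∈S∩N[x]
    ... | y∈S , y∈N[x] with ∈∪⁻ (adj G x) ⁅ x ⁆ y∈N[x]
    ... | inj₂ y∈⁅x⁆ = y∈S , inj₁ (∈⟦⟧⁻ (_≟ x) y∈⁅x⁆)
    ... | inj₁ x~y with ∉─⁻ (adj G x) ⟦ farNonNeighbour? ⟧ y∉completeToFar
    ...   | inj₁ x≁y = ⊥-elim (~-≁⇒≢ x~y x≁y refl)
    ...   | inj₂ has = y∈S , inj₂ (x~y , ∈⟦⟧⁻ farNonNeighbour? has)

    x∈near : x ∈ near
    x∈near = ∈─⁺ (S ∩ closedNbhd) completeToFar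
      (∈∩⁺ S closedNbhd x∈S (∈∪⁺ʳ (adj G x) ⁅ x ⁆ (∈⟦⟧⁺ (_≟ x) refl)))
      (∉─⁺ (adj G x) ⟦ farNonNeighbour? ⟧ (irrefl G x))

    joined⊆S : joined ⊆ S
    joined⊆S = proj₁ ∘ joined⁻

    near⊆S : near ⊆ S
    near⊆S = proj₁ ∘ near⁻

    far⊆S : far ⊆ S
    far⊆S = proj₁ ∘ far⁻

    far-clique : IsClique far
    far-clique y∈far z∈far y≢z = ¬≁⇒~ λ y≁z →
      let y∈S , x≁y , y≢x = far⁻ y∈far
          z∈S , x≁z , z≢x = far⁻ z∈far
      in S-triple-free x∈S y∈S z∈S (y≢x ∘ ≡.sym) (z≢x ∘ ≡.sym) y≢z x≁y x≁z y≁z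

    near-≁-far : ∀ {y z} → y ∈ near → z ∈ far → y ≁ z
    near-≁-far y∈near z∈far with near⁻ y∈near | far⁻ z∈far
    ... | _ , inj₁ refl | _ , x≁z , _ = x≁z
    ... | y∈S , inj₂ (x~y , w , w∈far , y≁w) | z∈S , x≁z , _ = ¬~⇒≁ λ y~z →
      let w∈S , x≁w , _ = far⁻ w∈far
          z~w = far-clique z∈far w∈far (~-≁⇒≢ y~z y≁w)
      in S-P₄-free x∈S y∈S z∈S w∈S x~y y~z z~w x≁z y≁w x≁w

    near-clique : IsClique near
    near-clique y∈near z∈near y≢z with near⁻ y∈near | near⁻ z∈near
    ... | _ , inj₁ refl        | _ , inj₁ refl        = ⊥-elim (y≢z refl)
    ... | _ , inj₁ refl        | _ , inj₂ (x~z , _)   = x~z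
    ... | _ , inj₂ (x~y , _)   | _ , inj₁ refl        = ~-sym x~y
    ... | y∈S , inj₂ (x~y , w , w∈far , y≁w) | z∈S , inj₂ (x~z , _) = ¬≁⇒~ λ y≁z →
      let w∈S , x≁w , _ = far⁻ w∈far
      in S-triple-free y∈S z∈S w∈S y≢z (~-≁⇒≢ x~y x≁w) (~-≁⇒≢ x~z x≁w)
                       y≁z y≁w (near-≁-far z∈near w∈far)

    joined~far : Complete joined far
    joined~far u∈joined = proj₂ (proj₂ (joined⁻ u∈joined))

    joined~near : Complete joined near
    joined~near u∈joined y∈near with joined⁻ u∈joined | near⁻ y∈near
    ... | _ , x~u , _ | _ , inj₁ refl = ~-sym x~u
    ... | u∈S , x~u , u~far | y∈S , inj₂ (x~y , w , w∈far , y≁w) = ¬≁⇒~ λ u≁y →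
      let w∈S , x≁w , _ = far⁻ w∈far
      in S-P₄-free w∈S u∈S x∈S y∈S (~-sym (u~far w∈far)) (~-sym x~u) x~y
                   (≁-sym x≁w) u≁y (≁-sym y≁w)

    size : ∣ joined ∣ + (∣ near ∣ + ∣ far ∣) ≡ ∣ S ∣
    size = begin
      ∣ joined ∣ + (∣ near ∣ + ∣ far ∣) ≡⟨ +-assoc (∣ joined ∣) (∣ near ∣) (∣ far ∣) ⟨
      ∣ joined ∣ + ∣ near ∣ + ∣ far ∣
        ≡⟨ cong (_+ ∣ far ∣) (∣p∩q∣+∣p─q∣≡∣p∣ (S ∩ closedNbhd) completeToFar) ⟩
      ∣ S ∩ closedNbhd ∣ + ∣ far ∣      ≡⟨ ∣p∩q∣+∣p─q∣≡∣p∣ S closedNbhd ⟩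
      ∣ S ∣                             ∎
      where open ≡.≡-Reasoning

    ∣joined∣<∣S∣ : ∣ joined ∣ < ∣ S ∣
    ∣joined∣<∣S∣ = ≡.subst (∣ joined ∣ <_) size
      (m<m+n _ (<-≤-trans (x∈p⇒0<∣p∣ near x∈near) (m≤m+n _ _)))

    extend : HalfClique joined → ∀ B → B ⊆ S → IsClique B → Complete joined B →
             ∣ near ∣ + ∣ far ∣ ≤ 2 * ∣ B ∣ → HalfClique S
    extend C₂ B B⊆S B-clique joined~B ∣near∣+∣far∣≤2∣B∣ = record
      { clique   = C ∪ B
      ; clique⊆p = [ joined⊆S ∘ clique⊆p , B⊆S ] ∘ ∈∪⁻ C B
      ; isClique = clique-∪ isClique B-clique C~B
      ; half     = begin
          ∣ S ∣                             ≡⟨ size ⟨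
          ∣ joined ∣ + (∣ near ∣ + ∣ far ∣) ≤⟨ +-mono-≤ half ∣near∣+∣far∣≤2∣B∣ ⟩
          2 * ∣ C ∣ + 2 * ∣ B ∣             ≡⟨ *-distribˡ-+ 2 (∣ C ∣) (∣ B ∣) ⟨
          2 * (∣ C ∣ + ∣ B ∣)
            ≡⟨ cong (2 *_) (∣p∪q∣≡∣p∣+∣q∣ C B (complete⇒disjoint C~B)) ⟨
          2 * ∣ C ∪ B ∣                     ∎
      }
      where
      open HalfClique C₂ renaming (clique to C)
      open ≤-Reasoning
      C~B : Complete C B
      C~B = joined~B ∘ clique⊆p

    halfClique : HalfClique joined → HalfClique S
    halfClique C₂ with ∣ far ∣ ≤? ∣ near ∣
    ... | yes ∣far∣≤∣near∣ =
      extend C₂ near near⊆S near-clique joined~near (+-≤-double ≤-refl ∣far∣≤∣near∣)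
    ... | no  ∣far∣≰∣near∣ =
      extend C₂ far far⊆S far-clique joined~far (+-≤-double (≰⇒≥ ∣far∣≰∣near∣) ≤-refl)

  large-clique : ∀ p → IndependentTripleFree p → InducedP₄Free p → HalfClique p
  large-clique = WF.All.wfRec (On.wellFounded ∣_∣ <-wellFounded) 0ℓ _ step
    where
    step : ∀ p →
           (∀ {q} → ∣ q ∣ < ∣ p ∣ → IndependentTripleFree q → InducedP₄Free q → HalfClique q) →
           IndependentTripleFree p → InducedP₄Free p → HalfClique p
    step p recurse p-triple-free p-P₄-free with any? (λ y → p y ≟ᵇ true)
    ... | no empty = record
      { clique   = p
      ; clique⊆p = id
      ; isClique = λ y∈p _ _ → ⊥-elim (empty (_ , y∈p))
      ; half     = m≤m+n _ _
      }
    ... | yes (x , x∈p) = halfClique (recurse ∣joined∣<∣S∣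
      (IndependentTripleFree-⊆ joined⊆S p-triple-free) (InducedP₄Free-⊆ joined⊆S p-P₄-free))
      where open Decomposition p-triple-free p-P₄-free x∈p

  claw-free⇒nbhd-IndependentTripleFree : (claw Free) G → ∀ x → IndependentTripleFree (adj G x)
  claw-free⇒nbhd-IndependentTripleFree claw-free x {a} {b} {c} x~a x~b x~c a≢b a≢c b≢c a≁b a≁c b≁c =
    claw-free (embedding f preserve separated)
    where
    f : Fin 4 → V
    f zero                   = x
    f (suc zero)             = a
    f (suc (suc zero))       = b
    f (suc (suc (suc zero))) = c

    preserve : ∀ u v → adj G (f u) (f v) ≡ clawAdj u v
    preserve zero                   zero                   = irrefl G x
    preserve zero                   (suc zero)             = x~a
    preserve zero                   (suc (suc zero))       = x~b
    preserve zero                   (suc (suc (suc zero))) = x~c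
    preserve (suc zero)             zero                   = ~-sym x~a
    preserve (suc zero)             (suc zero)             = irrefl G a
    preserve (suc zero)             (suc (suc zero))       = a≁b
    preserve (suc zero)             (suc (suc (suc zero))) = a≁c
    preserve (suc (suc zero))       zero                   = ~-sym x~b
    preserve (suc (suc zero))       (suc zero)             = ≁-sym a≁b
    preserve (suc (suc zero))       (suc (suc zero))       = irrefl G b
    preserve (suc (suc zero))       (suc (suc (suc zero))) = b≁c
    preserve (suc (suc (suc zero))) zero                   = ~-sym x~c
    preserve (suc (suc (suc zero))) (suc zero)             = ≁-sym a≁c
    preserve (suc (suc (suc zero))) (suc (suc zero))       = ≁-sym b≁c
    preserve (suc (suc (suc zero))) (suc (suc (suc zero))) = irrefl G c

    -- The three leaves of the claw are twins, so here injectivity needs a, b, c distinct.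
    separated : ∀ {u v} → Twins claw u v → f u ≡ f v → u ≡ v
    separated {zero}  {zero}  _    _  = refl
    separated {zero}  {suc v} twin _  with () ← twin (suc v)
    separated {suc u} {zero}  twin _  with () ← twin (suc u)
    separated {suc zero}             {suc zero}             _ _  = refl
    separated {suc zero}             {suc (suc zero)}       _ eq = ⊥-elim (a≢b eq)
    separated {suc zero}             {suc (suc (suc zero))} _ eq = ⊥-elim (a≢c eq)
    separated {suc (suc zero)}       {suc zero}             _ eq = ⊥-elim (a≢b (≡.sym eq))
    separated {suc (suc zero)}       {suc (suc zero)}       _ _  = refl
    separated {suc (suc zero)}       {suc (suc (suc zero))} _ eq = ⊥-elim (b≢c eq)
    separated {suc (suc (suc zero))} {suc zero}             _ eq = ⊥-elim (a≢c (≡.sym eq))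
    separated {suc (suc (suc zero))} {suc (suc zero)}       _ eq = ⊥-elim (b≢c (≡.sym eq))
    separated {suc (suc (suc zero))} {suc (suc (suc zero))} _ _  = refl

  gem-free⇒nbhd-InducedP₄Free : (gem Free) G → ∀ x → InducedP₄Free (adj G x)
  gem-free⇒nbhd-InducedP₄Free gem-free x {a} {b} {c} {d} x~a x~b x~c x~d a~b b~c c~d a≁c b≁d a≁d =
    gem-free (embedding f preserve (λ twin _ → gem-twinFree twin))
    where
    f : Fin 5 → V
    f zero                         = a
    f (suc zero)                   = b
    f (suc (suc zero))             = c
    f (suc (suc (suc zero)))       = d
    f (suc (suc (suc (suc zero)))) = x

    preserve : ∀ u v → adj G (f u) (f v) ≡ gemAdj u v
    preserve zero                         zero                         = irrefl G a
    preserve zero                         (suc zero)                   = a~b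
    preserve zero                         (suc (suc zero))             = a≁c
    preserve zero                         (suc (suc (suc zero)))       = a≁d
    preserve zero                         (suc (suc (suc (suc zero)))) = ~-sym x~a
    preserve (suc zero)                   zero                         = ~-sym a~b
    preserve (suc zero)                   (suc zero)                   = irrefl G b
    preserve (suc zero)                   (suc (suc zero))             = b~c
    preserve (suc zero)                   (suc (suc (suc zero)))       = b≁d
    preserve (suc zero)                   (suc (suc (suc (suc zero)))) = ~-sym x~b
    preserve (suc (suc zero))             zero                         = ≁-sym a≁c
    preserve (suc (suc zero))             (suc zero)                   = ~-sym b~c
    preserve (suc (suc zero))             (suc (suc zero))             = irrefl G c
    preserve (suc (suc zero))             (suc (suc (suc zero)))       = c~d
    preserve (suc (suc zero))             (suc (suc (suc (suc zero)))) = ~-sym x~c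
    preserve (suc (suc (suc zero)))       zero                         = ≁-sym a≁d
    preserve (suc (suc (suc zero)))       (suc zero)                   = ≁-sym b≁d
    preserve (suc (suc (suc zero)))       (suc (suc zero))             = ~-sym c~d
    preserve (suc (suc (suc zero)))       (suc (suc (suc zero)))       = irrefl G d
    preserve (suc (suc (suc zero)))       (suc (suc (suc (suc zero)))) = ~-sym x~d
    preserve (suc (suc (suc (suc zero)))) zero                         = x~a
    preserve (suc (suc (suc (suc zero)))) (suc zero)                   = x~b
    preserve (suc (suc (suc (suc zero)))) (suc (suc zero))             = x~c
    preserve (suc (suc (suc (suc zero)))) (suc (suc (suc zero)))       = x~d
    preserve (suc (suc (suc (suc zero)))) (suc (suc (suc (suc zero)))) = irrefl G x

  degree-bound : (gem Free) G → (claw Free) G → ∀ {w} → ¬ HasClique G (suc (suc w)) →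
                 ∀ x → ∣ adj G x ∣ ≤ 2 * w
  degree-bound gem-free claw-free {w} no-clique x = ≤-trans half (*-monoʳ-≤ 2 ∣clique∣≤w)
    where
    open HalfClique (large-clique (adj G x) (claw-free⇒nbhd-IndependentTripleFree claw-free x)
                                            (gem-free⇒nbhd-InducedP₄Free gem-free x))
    ∣clique∣≤w : ∣ clique ∣ ≤ w
    ∣clique∣≤w = ≮⇒≥ λ w<∣clique∣ →
      no-clique (HasClique-≤ (s≤s w<∣clique∣) (cone-clique x clique clique⊆p isClique))

  ProperBelow : ∀ {k} → ℕ → (V → Fin k) → Set
  ProperBelow m col = ∀ {u v} → toℕ u < m → toℕ v < m → u ~ v → col u ≢ col v

  greedy-colouring : ∀ d → (∀ x → ∣ adj G x ∣ ≤ d) → Colorable G (suc d)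
  greedy-colouring d Δ≤d =
    let col , proper = colour-below (n G) ≤-refl in col , λ u v u~v → proper (toℕ<n u) (toℕ<n v) u~v
    where
    extend : ∀ {m} → m < n G → ∀ col → ProperBelow m col →
             Σ (V → Fin (suc d)) (ProperBelow (suc m))
    extend {m} m<n col proper = col′ , proper′
      where
      x : V
      x = fromℕ< m<n

      free : ∃ λ c → ∀ {y} → x ~ y → col y ≢ c
      free = free-colour col (adj G x) (s≤s (Δ≤d x))

      col′ : V → Fin (suc d)
      col′ y = if does (y ≟ x) then proj₁ free else col y

      earlier : ∀ {y} → toℕ y < suc m → y ≢ x → toℕ y < m
      earlier y<m+1 y≢x = ≤∧≢⇒< (s≤s⁻¹ y<m+1) λ y≡m →
        y≢x (toℕ-injective (≡.trans y≡m (≡.sym (toℕ-fromℕ< m<n))))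

      proper′ : ProperBelow (suc m) col′
      proper′ {u} {v} u<m+1 v<m+1 u~v with u ≟ x | v ≟ x
      ... | yes refl | yes refl = ⊥-elim (~⇒≢ u~v refl)
      ... | yes refl | no  _    = ≢-sym (proj₂ free u~v)
      ... | no  _    | yes refl = proj₂ free (~-sym u~v)
      ... | no  u≢x  | no  v≢x  = proper (earlier u<m+1 u≢x) (earlier v<m+1 v≢x) u~v

    colour-below : ∀ m → m ≤ n G → Σ (V → Fin (suc d)) (ProperBelow m)
    colour-below zero    _   = (λ _ → zero) , λ ()
    colour-below (suc m) m<n =
      let col , proper = colour-below m (≤-trans (n≤1+n m) m<n) in extend m<n col proper

corollary1 : (G : Graph) → (gem Free) G → (claw Free) G →
    (w : ℕ) → IsCliqueNumber G w → Colorable G (2 * w ∸ 1)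
corollary1 G gem-free claw-free zero    (_ , no-clique) =
  (λ x → ⊥-elim (no-clique (vertex-clique G x))) , λ x → ⊥-elim (no-clique (vertex-clique G x))
corollary1 G gem-free claw-free (suc w) (_ , no-clique) =
  ≡.subst (Colorable G) (≡.sym (cong (_∸ 1) (*-suc 2 w)))
    (greedy-colouring G (2 * w) (degree-bound G gem-free claw-free no-clique))
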